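{- Let $p$ be a prime, $t\ge1$, and $n\ge K\ge1$. Then \[\Phi(n,K,p^t)\le p^{t-1}\cdot\Phi(n,K,p).\]
   Context: A linear code of length $n$ over $\mathbb{Z}_{p^t}$ is a $\mathbb{Z}_{p^t}$-submodule $\mathcal{C}$ of $(\mathbb{Z}_{p^t})^n$; it is isomorphic to $(\mathbb{Z}_{p^t})^{k_1}\times(\mathbb{Z}_{p^{t-1}})^{k_2}\times\cdots\times(\mathbb{Z}_p)^{k_t}$ and its rank is $K=\sum_i k_i$ (for $t=1$ rank equals dimension). The Lee weight of $a\in\mathbb{Z}_q$ (as an integer in $\{0,\dots,q-1\}$) is $\min\{a,q-a\}$, the Lee weight of a vector is the sum over coordinates, and $d_L(\mathcal{C})$ is the minimum Lee weight of a nonzero codeword. $\Phi(n,K,p^t)$ is the maximum of $d_L(\mathcal{C})$ over all linear codes $\mathcal{C}\subseteq(\mathbb{Z}_{p^t})^n$ of rank $K$. -}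

module Defs where

open import Data.Nat using (ℕ; zero; suc; _+_; _*_; _∸_; _^_; _≤_; _<_; _⊓_; NonZero)
open import Data.Nat.Properties using (m^n≢0)
open import Data.Nat.DivMod using (_mod_)
open import Data.Nat.Primality using (Prime; prime⇒nonZero)
open import Data.Fin using (Fin; toℕ)
open import Data.Vec using (Vec; lookup; tabulate; replicate)
open import Data.Product using (Σ; ∃; _×_; _,_)
open import Relation.Binary.PropositionalEquality using (_≡_)
open import Relation.Nullary using (¬_)

sumFin : (K : ℕ) → (Fin K → ℕ) → ℕ
sumFin zero    f = 0
sumFin (suc K) f = f Fin.zero + sumFin K (λ j → f (Fin.suc j))

-- Everything below concerns the ring ℤ_{p^t}, with elements Fin (p ^ t)
-- (representatives 0, …, p^t - 1) and words of length n in Vec (Fin (p ^ t)) n.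
module Codes (p t : ℕ) .{{p≢0 : NonZero p}} where

  q : ℕ
  q = p ^ t

  instance
    q≢0 : NonZero q
    q≢0 = m^n≢0 p t

  Zq : Set
  Zq = Fin q

  Word : ℕ → Set
  Word n = Vec Zq n

  _+q_ : Zq → Zq → Zq
  a +q b = (toℕ a + toℕ b) mod q

  _*q_ : Zq → Zq → Zq
  a *q b = (toℕ a * toℕ b) mod q

  0q : Zq
  0q = 0 mod q

  0w : ∀ {n} → Word n
  0w = replicate _ 0q

  _+w_ : ∀ {n} → Word n → Word n → Word n
  x +w y = tabulate (λ i → lookup x i +q lookup y i)

  _·w_ : ∀ {n} → Zq → Word n → Word n
  r ·w x = tabulate (λ i → r *q lookup x i)

  leeZ : Zq → ℕ
  leeZ a = toℕ a ⊓ (q ∸ toℕ a)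

  leeW : ∀ {n} → Word n → ℕ
  leeW {n} x = sumFin n (λ i → leeZ (lookup x i))

  record IsLinearCode {n : ℕ} (C : Word n → Set) : Set where
    field
      has-0 : C 0w
      +-closed : ∀ x y → C x → C y → C (x +w y)
      ·-closed : ∀ r x → C x → C (r ·w x)

  -- C has rank K: C ≅ ∏_{j<K} ℤ_{p^{e j}} with 1 ≤ e j ≤ t
  -- (equivalently C ≅ ℤ_{p^t}^{k_1} × ⋯ × ℤ_p^{k_t} with Σ k_i = K).
  -- Every homomorphism ∏_j ℤ_{p^{e j}} → (ℤ_q)^n has the form
  -- c ↦ Σ_j c_j p^{t - e j} g_j for some words g_j; we require it to be
  -- a bijection onto C.
  embed : ∀ {n K} → (Fin K → ℕ) → (Fin K → Word n) → (Fin K → ℕ) → Word n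
  embed {n} {K} e g c =
    tabulate (λ i → sumFin K (λ j → c j * p ^ (t ∸ e j) * toℕ (lookup (g j) i)) mod q)

  HasRank : ∀ {n} → (Word n → Set) → ℕ → Set
  HasRank {n} C K =
    Σ (Fin K → ℕ) λ e → Σ (Fin K → Word n) λ g →
      (∀ j → 1 ≤ e j × e j ≤ t)
      × (∀ (c : Fin K → ℕ) → (∀ j → c j < p ^ e j) → C (embed e g c))
      × (∀ x → C x → Σ (Fin K → ℕ) λ c → (∀ j → c j < p ^ e j) × embed e g c ≡ x)
      × (∀ (c c' : Fin K → ℕ) → (∀ j → c j < p ^ e j) → (∀ j → c' j < p ^ e j)
           → embed e g c ≡ embed e g c' → ∀ j → c j ≡ c' j)

  IsMinLee : ∀ {n} → (Word n → Set) → ℕ → Set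
  IsMinLee C d =
    (Σ _ λ x → C x × ¬ (x ≡ 0w) × leeW x ≡ d)
    × (∀ x → C x → ¬ (x ≡ 0w) → d ≤ leeW x)

  record RankCode (n K : ℕ) : Set₁ where
    field
      C : Word n → Set
      linear : IsLinearCode C
      rank : HasRank C K

  IsΦ : ℕ → ℕ → ℕ → Set₁
  IsΦ n K d =
    (Σ (RankCode n K) λ R → IsMinLee (RankCode.C R) d)
    × (∀ (R : RankCode n K) d' → IsMinLee (RankCode.C R) d' → d' ≤ d)

IsΦ : (p : ℕ) → Prime p → (t n K d : ℕ) → Set₁
IsΦ p pp t n K d = Codes.IsΦ p t {{prime⇒nonZero pp}} n K d

{-# OPTIONS --safe #-}
module Submission where

-- Let C ⊆ ℤ_{p^t}^n have rank K, presented as c ↦ Σ_j c_j p^{t-e_j} g_j. For 0 ≤ a_j < p it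
-- contains Σ_j a_j p^{e_j-1} p^{t-e_j} g_j = p^{t-1} Σ_j a_j g_j, i.e. the image under
-- x ↦ p^{t-1} x of the code D ⊆ ℤ_p^n spanned by the g_j mod p; D has rank K because the
-- presentation of C is injective. Multiplication by p^{t-1} maps ℤ_p into ℤ_{p^t} and multiplies
-- Lee weights by p^{t-1}, so Φ(n,K,p^t) = d_L(C) ≤ p^{t-1} d_L(D) ≤ p^{t-1} Φ(n,K,p).

open import Defs
open import Data.Nat
  using (ℕ; zero; suc; _+_; _*_; _∸_; _^_; _≤_; _<_; _⊓_; NonZero; s≤s; >-nonZero⁻¹; nonTrivial⇒n>1)
open import Data.Nat.Properties
open import Data.Nat.DivMod
  using (_%_; _mod_; %-distribˡ-+; %-distribˡ-*; m%n%n≡m%n; m%n<n; m<n⇒m%n≡m; m%n*o≡m*o%[n*o]; %-congʳ)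
open import Data.Nat.Primality using (Prime; prime⇒nonZero; prime⇒nonTrivial)
open import Data.Fin as Fin using (Fin; toℕ; fromℕ<; finToFun; funToFin)
open import Data.Fin.Properties using (toℕ-injective; toℕ-fromℕ<; toℕ<n; finToFun-funToFin)
open import Data.Vec using (lookup; map)
open import Data.Vec.Properties using (lookup∘tabulate; tabulate-cong; lookup-map; lookup-replicate; ≡-dec)
open import Data.Vec.Relation.Binary.Pointwise.Extensional using (ext; Pointwise-≡⇒≡)
open import Data.List using (allFin; filter)
open import Data.List.Extrema.Nat using (argmin; argmin-all; f[argmin]≤f[xs])
open import Data.List.Relation.Unary.All as All using ()
open import Data.List.Relation.Unary.All.Properties using (all-filter)
open import Data.List.Membership.Propositional.Properties using (∈-allFin; ∈-filter⁺)
open import Data.Product using (∃; Σ-syntax; _×_; _,_; proj₁; proj₂; uncurry)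
open import Function using (_∘_; case_of_)
open import Relation.Binary.PropositionalEquality
open import Relation.Nullary using (¬_; ¬?)
open import Relation.Unary using (Pred; Decidable)
open import Algebra.Properties.CommutativeSemigroup +-commutativeSemigroup
  using () renaming (interchange to +-interchange)
open import Algebra.Properties.CommutativeSemigroup *-commutativeSemigroup
  using () renaming (x∙yz≈y∙xz to m*[n*o]≡n*[m*o])

sumFin-cong : ∀ K {f g : Fin K → ℕ} → (∀ j → f j ≡ g j) → sumFin K f ≡ sumFin K g
sumFin-cong zero    f≗g = refl
sumFin-cong (suc K) f≗g = cong₂ _+_ (f≗g Fin.zero) (sumFin-cong K (f≗g ∘ Fin.suc))

sumFin-zero : ∀ K → sumFin K (λ _ → 0) ≡ 0
sumFin-zero zero    = refl
sumFin-zero (suc K) = sumFin-zero K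

sumFin-+ : ∀ K (f g : Fin K → ℕ) → sumFin K (λ j → f j + g j) ≡ sumFin K f + sumFin K g
sumFin-+ zero    f g = refl
sumFin-+ (suc K) f g = trans
  (cong (f Fin.zero + g Fin.zero +_) (sumFin-+ K (f ∘ Fin.suc) (g ∘ Fin.suc)))
  (+-interchange (f Fin.zero) (g Fin.zero) _ _)

*-distribˡ-sumFin : ∀ K m (f : Fin K → ℕ) → m * sumFin K f ≡ sumFin K (λ j → m * f j)
*-distribˡ-sumFin zero    m f = *-zeroʳ m
*-distribˡ-sumFin (suc K) m f = trans
  (*-distribˡ-+ m (f Fin.zero) _)
  (cong (m * f Fin.zero +_) (*-distribˡ-sumFin K m (f ∘ Fin.suc)))

sumFin-% : ∀ K n .{{_ : NonZero n}} {f g : Fin K → ℕ} →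
           (∀ j → f j % n ≡ g j % n) → sumFin K f % n ≡ sumFin K g % n
sumFin-% zero    n f≡g = refl
sumFin-% (suc K) n {f} {g} f≡g = begin
  (f Fin.zero + sumFin K (f ∘ Fin.suc)) % n
    ≡⟨ %-distribˡ-+ (f Fin.zero) _ n ⟩
  (f Fin.zero % n + sumFin K (f ∘ Fin.suc) % n) % n
    ≡⟨ cong₂ (λ a b → (a + b) % n) (f≡g Fin.zero) (sumFin-% K n (f≡g ∘ Fin.suc)) ⟩
  (g Fin.zero % n + sumFin K (g ∘ Fin.suc) % n) % n
    ≡⟨ %-distribˡ-+ (g Fin.zero) _ n ⟨
  (g Fin.zero + sumFin K (g ∘ Fin.suc)) % n
    ∎
  where open ≡-Reasoning

m*[n%o]%o≡m*n%o : ∀ m n o .{{_ : NonZero o}} → m * (n % o) % o ≡ m * n % o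
m*[n%o]%o≡m*n%o m n o = begin
  m * (n % o) % o          ≡⟨ %-distribˡ-* m (n % o) o ⟩
  m % o * (n % o % o) % o  ≡⟨ cong (λ k → m % o * k % o) (m%n%n≡m%n n o) ⟩
  m % o * (n % o) % o      ≡⟨ %-distribˡ-* m n o ⟨
  m * n % o                ∎
  where open ≡-Reasoning

m%o*n%o≡m*n%o : ∀ m n o .{{_ : NonZero o}} → m % o * n % o ≡ m * n % o
m%o*n%o≡m*n%o m n o = begin
  m % o * n % o    ≡⟨ cong (_% o) (*-comm (m % o) n) ⟩
  n * (m % o) % o  ≡⟨ m*[n%o]%o≡m*n%o n m o ⟩
  n * m % o        ≡⟨ cong (_% o) (*-comm n m) ⟩
  m * n % o        ∎
  where open ≡-Reasoning

toℕ∘finToFun-surjective : ∀ {m K} (c : Fin K → ℕ) → (∀ j → c j < m) →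
                          ∃ λ (k : Fin (m ^ K)) → ∀ j → toℕ (finToFun k j) ≡ c j
toℕ∘finToFun-surjective c c<m =
  funToFin (λ j → fromℕ< (c<m j)) ,
  λ j → trans (cong toℕ (finToFun-funToFin _ j)) (toℕ-fromℕ< _)

argmin-Fin : ∀ {N ℓ} {P : Pred (Fin N) ℓ} → Decidable P → (w : Fin N → ℕ) →
             ∀ {k₀} → P k₀ → ∃ λ k → P k × ∀ k′ → P k′ → w k ≤ w k′
argmin-Fin {N} P? w {k₀} Pk₀ =
  argmin w k₀ candidates ,
  argmin-all w Pk₀ (all-filter P? (allFin N)) ,
  λ k′ Pk′ → All.lookup (f[argmin]≤f[xs] k₀ candidates) (∈-filter⁺ P? (∈-allFin k′) Pk′)
  where candidates = filter P? (allFin N)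

ones : ∀ {K} → Fin K → ℕ
ones _ = 1

module CodeProperties (p t : ℕ) .{{_ : NonZero p}} where
  open Codes p t

  toℕ∘lookup-injective : ∀ {n} {x y : Word n} →
                         (∀ i → toℕ (lookup x i) ≡ toℕ (lookup y i)) → x ≡ y
  toℕ∘lookup-injective eq = Pointwise-≡⇒≡ (ext (toℕ-injective ∘ eq))

  toℕ-0w : ∀ {n} (i : Fin n) → toℕ (lookup 0w i) ≡ 0
  toℕ-0w i = trans (cong toℕ (lookup-replicate i 0q)) (trans (toℕ-fromℕ< _) (m<n⇒m%n≡m (>-nonZero⁻¹ q)))

  toℕ-+w : ∀ {n} (x y : Word n) i →
           toℕ (lookup (x +w y) i) ≡ (toℕ (lookup x i) + toℕ (lookup y i)) % q
  toℕ-+w x y i = trans (cong toℕ (lookup∘tabulate _ i)) (toℕ-fromℕ< _)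

  toℕ-·w : ∀ {n} r (x : Word n) i → toℕ (lookup (r ·w x) i) ≡ toℕ r * toℕ (lookup x i) % q
  toℕ-·w r x i = trans (cong toℕ (lookup∘tabulate _ i)) (toℕ-fromℕ< _)

  p^e*p^[t∸e]≡q : ∀ {e} → e ≤ t → p ^ e * p ^ (t ∸ e) ≡ q
  p^e*p^[t∸e]≡q {e} e≤t = trans (sym (^-distribˡ-+-* p e (t ∸ e))) (cong (p ^_) (m+[n∸m]≡n e≤t))

  -- Instance search does not derive NonZero (p ^ k) for a variable k.
  _%p^_ : ℕ → ℕ → ℕ
  m %p^ k = _%_ m (p ^ k) {{m^n≢0 p k}}

  Bounded : ∀ {K} → (Fin K → ℕ) → (Fin K → ℕ) → Set
  Bounded e c = ∀ j → c j < p ^ e j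

  module _ {n K : ℕ} (e : Fin K → ℕ) (g : Fin K → Word n) where

    embedℕ : (Fin K → ℕ) → Fin n → ℕ
    embedℕ c i = sumFin K (λ j → c j * p ^ (t ∸ e j) * toℕ (lookup (g j) i))

    toℕ-embed : ∀ c i → toℕ (lookup (embed e g c) i) ≡ embedℕ c i % q
    toℕ-embed c i = trans (cong toℕ (lookup∘tabulate _ i)) (toℕ-fromℕ< _)

    embed-cong : ∀ {c c′} → (∀ j → c j ≡ c′ j) → embed e g c ≡ embed e g c′
    embed-cong c≗c′ = tabulate-cong λ i → cong (_mod q) (sumFin-cong K λ j →
      cong (λ a → a * p ^ (t ∸ e j) * toℕ (lookup (g j) i)) (c≗c′ j))

    embed-zero : embed e g (λ _ → 0) ≡ 0w
    embed-zero = toℕ∘lookup-injective λ i → begin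
      toℕ (lookup (embed e g (λ _ → 0)) i)  ≡⟨ toℕ-embed (λ _ → 0) i ⟩
      sumFin K (λ _ → 0) % q               ≡⟨ cong (_% q) (sumFin-zero K) ⟩
      0 % q                                ≡⟨ m<n⇒m%n≡m (>-nonZero⁻¹ q) ⟩
      0                                    ≡⟨ toℕ-0w i ⟨
      toℕ (lookup 0w i)                    ∎
      where open ≡-Reasoning

    embed-+ : ∀ c c′ → embed e g (λ j → c j + c′ j) ≡ embed e g c +w embed e g c′
    embed-+ c c′ = toℕ∘lookup-injective λ i → begin
      toℕ (lookup (embed e g (λ j → c j + c′ j)) i)
        ≡⟨ toℕ-embed (λ j → c j + c′ j) i ⟩
      embedℕ (λ j → c j + c′ j) i % q
        ≡⟨ cong (_% q) (trans (sumFin-cong K λ j → distrib (c j) (c′ j) _ _) (sumFin-+ K _ _)) ⟩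
      (embedℕ c i + embedℕ c′ i) % q
        ≡⟨ %-distribˡ-+ (embedℕ c i) _ q ⟩
      (embedℕ c i % q + embedℕ c′ i % q) % q
        ≡⟨ cong₂ (λ a b → (a + b) % q) (toℕ-embed c i) (toℕ-embed c′ i) ⟨
      (toℕ (lookup (embed e g c) i) + toℕ (lookup (embed e g c′) i)) % q
        ≡⟨ toℕ-+w (embed e g c) (embed e g c′) i ⟨
      toℕ (lookup (embed e g c +w embed e g c′) i)
        ∎
      where
      open ≡-Reasoning
      distrib : ∀ a b k x → (a + b) * k * x ≡ a * k * x + b * k * x
      distrib a b k x = trans (cong (_* x) (*-distribʳ-+ k a b)) (*-distribʳ-+ x (a * k) (b * k))

    embed-· : ∀ r c → embed e g (λ j → toℕ r * c j) ≡ r ·w embed e g c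
    embed-· r c = toℕ∘lookup-injective λ i → begin
      toℕ (lookup (embed e g (λ j → toℕ r * c j)) i)
        ≡⟨ toℕ-embed (λ j → toℕ r * c j) i ⟩
      embedℕ (λ j → toℕ r * c j) i % q
        ≡⟨ cong (_% q) (trans (sumFin-cong K λ j → assoc (toℕ r) (c j) _ _)
                              (sym (*-distribˡ-sumFin K (toℕ r) _))) ⟩
      toℕ r * embedℕ c i % q
        ≡⟨ m*[n%o]%o≡m*n%o (toℕ r) _ q ⟨
      toℕ r * (embedℕ c i % q) % q
        ≡⟨ cong (λ a → toℕ r * a % q) (toℕ-embed c i) ⟨
      toℕ r * toℕ (lookup (embed e g c) i) % q
        ≡⟨ toℕ-·w r (embed e g c) i ⟨
      toℕ (lookup (r ·w embed e g c) i)
        ∎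
      where
      open ≡-Reasoning
      assoc : ∀ a b k x → a * b * k * x ≡ a * (b * k * x)
      assoc a b k x = trans (cong (_* x) (*-assoc a b k)) (*-assoc a (b * k) x)

    embed-mod : (∀ j → e j ≤ t) → ∀ c → embed e g c ≡ embed e g (λ j → c j %p^ e j)
    embed-mod e≤t c = toℕ∘lookup-injective λ i → begin
      toℕ (lookup (embed e g c) i)                      ≡⟨ toℕ-embed c i ⟩
      embedℕ c i % q                                   ≡⟨ sumFin-% K q (λ j → term j i) ⟨
      embedℕ (λ j → c j %p^ e j) i % q                  ≡⟨ toℕ-embed (λ j → c j %p^ e j) i ⟨
      toℕ (lookup (embed e g (λ j → c j %p^ e j)) i)    ∎
      where
      open ≡-Reasoning
      term : ∀ j i → c j %p^ e j * p ^ (t ∸ e j) * toℕ (lookup (g j) i) % q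
                   ≡ c j * p ^ (t ∸ e j) * toℕ (lookup (g j) i) % q
      term j i = begin
        c j %p^ e j * p ^ (t ∸ e j) * x % q
          ≡⟨ cong (λ a → a * x % q) (m%n*o≡m*o%[n*o] (c j) (p ^ e j) (p ^ (t ∸ e j))) ⟩
        c j * p ^ (t ∸ e j) % (p ^ e j * p ^ (t ∸ e j)) * x % q
          ≡⟨ cong (λ a → a * x % q) (%-congʳ (p^e*p^[t∸e]≡q (e≤t j))) ⟩
        c j * p ^ (t ∸ e j) % q * x % q
          ≡⟨ m%o*n%o≡m*n%o (c j * p ^ (t ∸ e j)) x q ⟩
        c j * p ^ (t ∸ e j) * x % q
          ∎
        where
        x = toℕ (lookup (g j) i)
        instance
          _ : NonZero (p ^ e j)
          _ = m^n≢0 p (e j)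
          _ : NonZero (p ^ e j * p ^ (t ∸ e j))
          _ = m*n≢0 (p ^ e j) (p ^ (t ∸ e j)) {{m^n≢0 p (e j)}} {{m^n≢0 p (t ∸ e j)}}

    Span : Word n → Set
    Span x = ∃ λ c → embed e g c ≡ x

    span-isLinearCode : IsLinearCode Span
    span-isLinearCode = record
      { has-0    = (λ _ → 0) , embed-zero
      ; +-closed = λ { _ _ (c , refl) (c′ , refl) → (λ j → c j + c′ j) , embed-+ c c′ }
      ; ·-closed = λ { r _ (c , refl) → (λ j → toℕ r * c j) , embed-· r c }
      }

    span-bounded : (∀ j → e j ≤ t) → ∀ {x} → Span x → ∃ λ c → Bounded e c × embed e g c ≡ x
    span-bounded e≤t (c , refl) =
      (λ j → c j %p^ e j) , (λ j → m%n<n (c j) (p ^ e j) {{m^n≢0 p (e j)}}) , sym (embed-mod e≤t c)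

    span-hasRank : (∀ j → 1 ≤ e j × e j ≤ t) →
                   (∀ c c′ → Bounded e c → Bounded e c′ → embed e g c ≡ embed e g c′ →
                    ∀ j → c j ≡ c′ j) →
                   HasRank Span K
    span-hasRank bounds injective =
      e , g , bounds , (λ c _ → c , refl) , (λ _ → span-bounded (proj₂ ∘ bounds)) , injective

  finite-image⇒∃minLee : ∀ {n N} {C : Word n → Set} (word : Fin N → Word n) →
                         (∀ k → C (word k)) → (∀ x → C x → ∃ λ k → word k ≡ x) →
                         ∀ {x₀} → C x₀ → ¬ x₀ ≡ 0w → ∃ λ d → IsMinLee C d
  finite-image⇒∃minLee word in-C onto Cx₀ x₀≢0 with onto _ Cx₀
  ... | k₀ , refl with argmin-Fin (λ k → ¬? (≡-dec Fin._≟_ (word k) 0w)) (leeW ∘ word) x₀≢0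
  ... | k , k≢0 , least =
    leeW (word k) , (word k , in-C k , k≢0 , refl) ,
    λ x Cx x≢0 → case onto x Cx of λ { (k′ , refl) → least k′ x≢0 }

  hasRank⇒∃minLee : ∀ {n K} {C : Word n → Set} → 1 < p → 0 < K → HasRank C K →
                    ∃ λ d → IsMinLee C d
  hasRank⇒∃minLee {n} {K} {C} 1<p 0<K (e , g , bounds , rin , rsurj , rinj) =
    finite-image⇒∃minLee word (λ k → rin _ (residue-bounded k)) onto (rin ones ones-bounded) ones≢0
    where
    -- Reducing modulo p ^ e j makes every index name a codeword, so no index has to be filtered out.
    residue : Fin (q ^ K) → Fin K → ℕ
    residue k j = toℕ (finToFun k j) %p^ e j

    residue-bounded : ∀ k → Bounded e (residue k)
    residue-bounded k j = m%n<n _ (p ^ e j) {{m^n≢0 p (e j)}}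

    word : Fin (q ^ K) → Word n
    word k = embed e g (residue k)

    p^e≤q : ∀ j → p ^ e j ≤ q
    p^e≤q j = ^-monoʳ-≤ p (proj₂ (bounds j))

    onto : ∀ x → C x → ∃ λ k → word k ≡ x
    onto x Cx with rsurj x Cx
    ... | c , bc , c↦x with toℕ∘finToFun-surjective c (λ j → <-≤-trans (bc j) (p^e≤q j))
    ... | k , k≗c = k , trans (embed-cong e g residue≗c) c↦x
      where
      residue≗c : ∀ j → residue k j ≡ c j
      residue≗c j = trans (cong (_%p^ e j) (k≗c j)) (m<n⇒m%n≡m {{m^n≢0 p (e j)}} (bc j))

    ones-bounded : Bounded e ones
    ones-bounded j = ^-monoʳ-< p 1<p (proj₁ (bounds j))

    ones≢0 : ¬ embed e g ones ≡ 0w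
    ones≢0 ones≡0 with rinj ones (λ _ → 0) ones-bounded (λ j → m^n>0 p (e j))
                          (trans ones≡0 (sym (embed-zero e g))) (fromℕ< 0<K)
    ... | ()

module Lift (p r s : ℕ) .{{_ : NonZero p}} where
  private
    module F = Codes p r
    module R = Codes p (r + s)
    module F′ = CodeProperties p r
    module R′ = CodeProperties p (r + s)
    instance
      p^s≢0 : NonZero (p ^ s)
      p^s≢0 = m^n≢0 p s

  p^[r+s]≡p^s*p^r : p ^ (r + s) ≡ p ^ s * p ^ r
  p^[r+s]≡p^s*p^r = trans (^-distribˡ-+-* p r s) (*-comm (p ^ r) (p ^ s))

  scale : F.Zq → R.Zq
  scale a = fromℕ< (subst (p ^ s * toℕ a <_) (sym p^[r+s]≡p^s*p^r) (*-monoʳ-< (p ^ s) (toℕ<n a)))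

  lift : ∀ {n} → F.Word n → R.Word n
  lift = map scale

  toℕ-lift : ∀ {n} (x : F.Word n) i → toℕ (lookup (lift x) i) ≡ p ^ s * toℕ (lookup x i)
  toℕ-lift x i = trans (cong toℕ (lookup-map i scale x)) (toℕ-fromℕ< _)

  lift-injective : ∀ {n} {x y : F.Word n} → lift x ≡ lift y → x ≡ y
  lift-injective {x = x} {y} eq = F′.toℕ∘lookup-injective λ i → *-cancelˡ-≡ _ _ (p ^ s)
    (trans (sym (toℕ-lift x i)) (trans (cong (λ z → toℕ (lookup z i)) eq) (toℕ-lift y i)))

  lift-0w : ∀ {n} → lift (F.0w {n}) ≡ R.0w
  lift-0w = R′.toℕ∘lookup-injective λ i → begin
    toℕ (lookup (lift F.0w) i)    ≡⟨ toℕ-lift F.0w i ⟩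
    p ^ s * toℕ (lookup F.0w i)   ≡⟨ cong (p ^ s *_) (F′.toℕ-0w i) ⟩
    p ^ s * 0                     ≡⟨ *-zeroʳ (p ^ s) ⟩
    0                             ≡⟨ R′.toℕ-0w i ⟨
    toℕ (lookup R.0w i)           ∎
    where open ≡-Reasoning

  p^s*[m%p^r]≡p^s*m%p^[r+s] : ∀ m → p ^ s * (m % p ^ r) ≡ (p ^ s * m) % p ^ (r + s)
  p^s*[m%p^r]≡p^s*m%p^[r+s] m = begin
    p ^ s * (m % p ^ r)            ≡⟨ *-comm (p ^ s) _ ⟩
    m % p ^ r * p ^ s              ≡⟨ m%n*o≡m*o%[n*o] m (p ^ r) (p ^ s) ⟩
    (m * p ^ s) % (p ^ r * p ^ s)  ≡⟨ %-congʳ (trans (*-comm (p ^ r) (p ^ s)) (sym p^[r+s]≡p^s*p^r)) ⟩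
    (m * p ^ s) % p ^ (r + s)      ≡⟨ cong (_% p ^ (r + s)) (*-comm m (p ^ s)) ⟩
    (p ^ s * m) % p ^ (r + s)      ∎
    where
    open ≡-Reasoning
    instance
      _ : NonZero (p ^ r * p ^ s)
      _ = m*n≢0 (p ^ r) (p ^ s)

  leeZ-scale : ∀ a → R.leeZ (scale a) ≡ p ^ s * F.leeZ a
  leeZ-scale a = begin
    toℕ (scale a) ⊓ (p ^ (r + s) ∸ toℕ (scale a))
      ≡⟨ cong (λ b → b ⊓ (p ^ (r + s) ∸ b)) (toℕ-fromℕ< _) ⟩
    (p ^ s * toℕ a) ⊓ (p ^ (r + s) ∸ p ^ s * toℕ a)
      ≡⟨ cong (λ m → (p ^ s * toℕ a) ⊓ (m ∸ p ^ s * toℕ a)) p^[r+s]≡p^s*p^r ⟩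
    (p ^ s * toℕ a) ⊓ (p ^ s * p ^ r ∸ p ^ s * toℕ a)
      ≡⟨ cong ((p ^ s * toℕ a) ⊓_) (*-distribˡ-∸ (p ^ s) (p ^ r) (toℕ a)) ⟨
    (p ^ s * toℕ a) ⊓ (p ^ s * (p ^ r ∸ toℕ a))
      ≡⟨ *-distribˡ-⊓ (p ^ s) (toℕ a) (p ^ r ∸ toℕ a) ⟨
    p ^ s * (toℕ a ⊓ (p ^ r ∸ toℕ a))
      ∎
    where open ≡-Reasoning

  leeW-lift : ∀ {n} (x : F.Word n) → R.leeW (lift x) ≡ p ^ s * F.leeW x
  leeW-lift {n} x = trans
    (sumFin-cong n λ i → trans (cong R.leeZ (lookup-map i scale x)) (leeZ-scale (lookup x i)))
    (sym (*-distribˡ-sumFin n (p ^ s) _))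

  minLee-lift : ∀ {n} {C : R.Word n → Set} {D : F.Word n → Set} {dC dD} →
                (∀ x → D x → C (lift x)) → R.IsMinLee C dC → F.IsMinLee D dD → dC ≤ p ^ s * dD
  minLee-lift {dC = dC} D⊆C (_ , leastC) ((x , Dx , x≢0 , refl) , _) =
    subst (dC ≤_) (leeW-lift x)
      (leastC (lift x) (D⊆C x Dx) (λ lift≡0 → x≢0 (lift-injective (trans lift≡0 (sym lift-0w)))))

module Socle (p s : ℕ) .{{_ : NonZero p}} where
  private
    module F = Codes p 1
    module R = Codes p (suc s)
    module F′ = CodeProperties p 1
    module R′ = CodeProperties p (suc s)
  open Lift p 1 s

  reduce : ∀ {n} → R.Word n → F.Word n
  reduce = map (λ a → toℕ a mod p ^ 1)

  p^[e∸1]*p^[1+s∸e]≡p^s : ∀ {e} → 1 ≤ e → e ≤ suc s → p ^ (e ∸ 1) * p ^ (suc s ∸ e) ≡ p ^ s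
  p^[e∸1]*p^[1+s∸e]≡p^s {suc e} _ (s≤s e≤s) =
    trans (sym (^-distribˡ-+-* p e (s ∸ e))) (cong (p ^_) (m+[n∸m]≡n e≤s))

  m*p^[e∸1]<p^e : ∀ {m e} → 1 ≤ e → m < p ^ 1 → m * p ^ (e ∸ 1) < p ^ e
  m*p^[e∸1]<p^e {m} {suc e} _ m<p = *-monoˡ-< (p ^ e) {{m^n≢0 p e}} (subst (m <_) (*-identityʳ p) m<p)

  module _ {n K} (e : Fin K → ℕ) (g : Fin K → R.Word n) where

    raise : (Fin K → ℕ) → Fin K → ℕ
    raise a j = a j * p ^ (e j ∸ 1)

    lift-embed : (∀ j → 1 ≤ e j × e j ≤ suc s) →
                 ∀ a → lift (F.embed ones (reduce ∘ g) a) ≡ R.embed e g (raise a)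
    lift-embed bounds a = R′.toℕ∘lookup-injective λ i → begin
      toℕ (lookup (lift (F.embed ones (reduce ∘ g) a)) i)
        ≡⟨ toℕ-lift (F.embed ones (reduce ∘ g) a) i ⟩
      p ^ s * toℕ (lookup (F.embed ones (reduce ∘ g) a) i)
        ≡⟨ cong (p ^ s *_) (F′.toℕ-embed ones (reduce ∘ g) a i) ⟩
      p ^ s * (F′.embedℕ ones (reduce ∘ g) a i % p ^ 1)
        ≡⟨ p^s*[m%p^r]≡p^s*m%p^[r+s] _ ⟩
      p ^ s * F′.embedℕ ones (reduce ∘ g) a i % R.q
        ≡⟨ cong (_% R.q) (*-distribˡ-sumFin K (p ^ s) _) ⟩
      sumFin K (λ j → p ^ s * (a j * 1 * toℕ (lookup (reduce (g j)) i))) % R.q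
        ≡⟨ sumFin-% K R.q (term i) ⟩
      R′.embedℕ e g (raise a) i % R.q
        ≡⟨ R′.toℕ-embed e g (raise a) i ⟨
      toℕ (lookup (R.embed e g (raise a)) i)
        ∎
      where
      open ≡-Reasoning
      term : ∀ i j → p ^ s * (a j * 1 * toℕ (lookup (reduce (g j)) i)) % R.q
                   ≡ raise a j * p ^ (suc s ∸ e j) * toℕ (lookup (g j) i) % R.q
      term i j = begin
        p ^ s * (a j * 1 * toℕ (lookup (reduce (g j)) i)) % R.q
          ≡⟨ cong (λ b → p ^ s * (a j * 1 * b) % R.q)
                  (trans (cong toℕ (lookup-map i _ (g j))) (toℕ-fromℕ< _)) ⟩
        p ^ s * (a j * 1 * (x % p ^ 1)) % R.q
          ≡⟨ cong (λ b → p ^ s * (b * (x % p ^ 1)) % R.q) (*-identityʳ (a j)) ⟩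
        p ^ s * (a j * (x % p ^ 1)) % R.q
          ≡⟨ cong (_% R.q) (m*[n*o]≡n*[m*o] (p ^ s) (a j) _) ⟩
        a j * (p ^ s * (x % p ^ 1)) % R.q
          ≡⟨ cong (λ b → a j * b % R.q) (p^s*[m%p^r]≡p^s*m%p^[r+s] x) ⟩
        a j * (p ^ s * x % R.q) % R.q
          ≡⟨ m*[n%o]%o≡m*n%o (a j) (p ^ s * x) R.q ⟩
        a j * (p ^ s * x) % R.q
          ≡⟨ cong (_% R.q) (*-assoc (a j) (p ^ s) x) ⟨
        a j * p ^ s * x % R.q
          ≡⟨ cong (λ b → a j * b * x % R.q) (uncurry p^[e∸1]*p^[1+s∸e]≡p^s (bounds j)) ⟨
        a j * (p ^ (e j ∸ 1) * p ^ (suc s ∸ e j)) * x % R.q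
          ≡⟨ cong (λ b → b * x % R.q) (*-assoc (a j) _ _) ⟨
        raise a j * p ^ (suc s ∸ e j) * x % R.q
          ∎
        where x = toℕ (lookup (g j) i)

  socle : ∀ {n K} (C : R.RankCode n K) →
          Σ[ D ∈ F.RankCode n K ] (∀ x → F.RankCode.C D x → R.RankCode.C C (lift x))
  socle record { C = C ; rank = e , g , bounds , rin , _ , rinj } =
    record { C      = F′.Span ones (reduce ∘ g)
           ; linear = F′.span-isLinearCode ones (reduce ∘ g)
           ; rank   = F′.span-hasRank ones (reduce ∘ g) (λ _ → ≤-refl , ≤-refl) injective
           } ,
    D⊆C
    where
    raise-bounded : ∀ {a} → F′.Bounded ones a → R′.Bounded e (raise e g a)
    raise-bounded ba j = m*p^[e∸1]<p^e (proj₁ (bounds j)) (ba j)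

    injective : ∀ a a′ → F′.Bounded ones a → F′.Bounded ones a′ →
                F.embed ones (reduce ∘ g) a ≡ F.embed ones (reduce ∘ g) a′ → ∀ j → a j ≡ a′ j
    injective a a′ ba ba′ eq j = *-cancelʳ-≡ (a j) (a′ j) (p ^ (e j ∸ 1)) {{m^n≢0 p (e j ∸ 1)}}
      (rinj (raise e g a) (raise e g a′) (raise-bounded ba) (raise-bounded ba′)
            (trans (sym (lift-embed e g bounds a)) (trans (cong lift eq) (lift-embed e g bounds a′))) j)

    D⊆C : ∀ x → F′.Span ones (reduce ∘ g) x → C (lift x)
    D⊆C x Dx with F′.span-bounded ones (reduce ∘ g) (λ _ → ≤-refl) Dx
    ... | a , ba , refl = subst C (sym (lift-embed e g bounds a)) (rin (raise e g a) (raise-bounded ba))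

lemma22 : (p : ℕ) (pp : Prime p) (t n K : ℕ) → 1 ≤ t → K ≤ n → 1 ≤ K →
    (Φt Φ1 : ℕ) → IsΦ p pp t n K Φt → IsΦ p pp 1 n K Φ1 →
    Φt ≤ p ^ (t ∸ 1) * Φ1
lemma22 p pp zero    n K () _ _ Φt Φ1 _ _
-- K ≤ n only ensures that optimal codes exist, which the two IsΦ hypotheses already provide.
lemma22 p pp (suc s) n K _ _ 0<K Φt Φ1 ((C , minC) , _) (_ , maxΦ1) =
  let D , D⊆C = socle C
      d , minD = hasRank⇒∃minLee 1<p 0<K (Codes.RankCode.rank D)
  in begin
    Φt          ≤⟨ minLee-lift D⊆C minC minD ⟩
    p ^ s * d   ≤⟨ *-monoʳ-≤ (p ^ s) (maxΦ1 D d minD) ⟩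
    p ^ s * Φ1  ∎
  where
  instance
    _ : NonZero p
    _ = prime⇒nonZero pp
  open Lift p 1 s
  open Socle p s
  open CodeProperties p 1 using (hasRank⇒∃minLee)
  open ≤-Reasoning
  1<p : 1 < p
  1<p = nonTrivial⇒n>1 p {{prime⇒nonTrivial pp}}
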